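{- Consider classical dense multiplication of $n\times n$ matrices $A\cdot B=C$ (computing $c_{ij}=\sum_{k=1}^n a_{ik}b_{kj}$ via the $n^3$ scalar products $a_{ik}b_{kj}$) by a parallel algorithm on a distributed-memory machine with $P$ processors. Suppose the algorithm begins with one copy of the input matrices (distributed among the processors' local memories) and minimizes computational costs in an asymptotic sense, i.e. its arithmetic running time is $O(n^3/P)$. Then, for sufficiently large $P$, some processor must send or receive at least $\Omega\!\left(\frac{n^2}{P^{2/3}}\right)$ words.
   Context: Distributed-memory model: each of the $P$ processors has its own local memory of arbitrary size; data not in a processor's local memory must be communicated, and the bandwidth cost is measured by the number of words a processor sends or receives. At the end of the algorithm each output entry must be fully computed and stored in some processor's local memory (possibly in several copies). No specific communication pattern is assumed. -}

module Defs where

open import Data.Nat using (ℕ; zero; suc; _+_; _*_; _^_; _≤_)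
open import Data.Fin using (Fin)
open import Data.Fin.Subset using (Subset; ⁅_⁆; _∪_; _∩_; Empty) renaming (⊤ to full)
open import Data.List using (List; []; _∷_)
open import Data.Product using (Σ; ∃-syntax; _×_)
open import Relation.Binary.PropositionalEquality using (_≡_)
open import Relation.Nullary using (Dec; yes; no)
open import Data.Fin using (_≟_)

-- The values ("words") that can occur in a classical algorithm:
--   inA i k     : the input entry a_ik
--   inB k j     : the input entry b_kj
--   psum i j S  : the partial sum  Σ_{k ∈ S} a_ik b_kj  (S ⊆ {0..n-1})
-- In particular the single product a_ik b_kj is psum i j ⁅ k ⁆ and the
-- output entry c_ij is psum i j full.
data Val (n : ℕ) : Set where
  inA  : Fin n → Fin n → Val n
  inB  : Fin n → Fin n → Val n
  psum : Fin n → Fin n → Subset n → Val n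

-- Events of an execution:
--   send q p v    : processor q sends the word v to processor p
--   mul p i j k   : processor p computes the scalar product a_ik * b_kj
--   add p i j S T : processor p adds two partial sums of c_ij (indices S, T)
data Event (n P : ℕ) : Set where
  send : Fin P → Fin P → Val n → Event n P
  mul  : Fin P → Fin n → Fin n → Fin n → Event n P
  add  : Fin P → Fin n → Fin n → Subset n → Subset n → Event n P

-- A trace is a list of events, MOST RECENT EVENT FIRST.
Trace : ℕ → ℕ → Set
Trace n P = List (Event n P)

-- Holds ownA ownB es p v : after trace es, processor p has value v in its
-- local memory (local memory is unbounded; nothing is ever discarded).
-- Initially each input entry is held by exactly one processor (its owner):
-- one copy of the input, distributed among the processors.
data Holds {n P : ℕ} (ownA ownB : Fin n → Fin n → Fin P)
     : Trace n P → Fin P → Val n → Set where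
  initA : ∀ {p i k} → ownA i k ≡ p → Holds ownA ownB [] p (inA i k)
  initB : ∀ {p k j} → ownB k j ≡ p → Holds ownA ownB [] p (inB k j)
  keep  : ∀ {es e p v} → Holds ownA ownB es p v → Holds ownA ownB (e ∷ es) p v
  recv  : ∀ {es q p v} → Holds ownA ownB (send q p v ∷ es) p v
  mulR  : ∀ {es p i j k} → Holds ownA ownB (mul p i j k ∷ es) p (psum i j ⁅ k ⁆)
  addR  : ∀ {es p i j S T} → Holds ownA ownB (add p i j S T ∷ es) p (psum i j (S ∪ T))

data Valid {n P : ℕ} (ownA ownB : Fin n → Fin n → Fin P) : Trace n P → Set where
  nil   : Valid ownA ownB []
  vsend : ∀ {es q p v} → Valid ownA ownB es → Holds ownA ownB es q v →
          Valid ownA ownB (send q p v ∷ es)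
  vmul  : ∀ {es p i j k} → Valid ownA ownB es →
          Holds ownA ownB es p (inA i k) → Holds ownA ownB es p (inB k j) →
          Valid ownA ownB (mul p i j k ∷ es)
  vadd  : ∀ {es p i j S T} → Valid ownA ownB es →
          Holds ownA ownB es p (psum i j S) → Holds ownA ownB es p (psum i j T) →
          Empty (S ∩ T) →
          Valid ownA ownB (add p i j S T ∷ es)

record Algorithm (n P : ℕ) : Set where
  field
    ownA   : Fin n → Fin n → Fin P   -- initial (single-copy) location of a_ik
    ownB   : Fin n → Fin n → Fin P   -- initial (single-copy) location of b_kj
    trace  : Trace n P
    valid  : Valid ownA ownB trace
    output : ∀ (i j : Fin n) → ∃[ p ] Holds ownA ownB trace p (psum i j full)

private
  is : ∀ {P} → Fin P → Fin P → ℕ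
  is p q with p ≟ q
  ... | yes _ = 1
  ... | no  _ = 0

flops : ∀ {n P} → Fin P → Trace n P → ℕ
flops p []                  = 0
flops p (send _ _ _ ∷ es)   = flops p es
flops p (mul q _ _ _ ∷ es)  = is p q + flops p es
flops p (add q _ _ _ _ ∷ es) = is p q + flops p es

words : ∀ {n P} → Fin P → Trace n P → ℕ
words p []                  = 0
words p (send q r _ ∷ es)   = is p q + is p r + words p es
words p (mul _ _ _ _ ∷ es)  = words p es
words p (add _ _ _ _ _ ∷ es) = words p es

-- Arithmetic running time ≤ a · n³ / P  (running time = the maximal number
-- of arithmetic operations performed by a single processor), stated without
-- division as  P · flops_p ≤ a · n³  for every processor p.
ComputeBound : ∀ {n P} → ℕ → Algorithm n P → Set
ComputeBound {n} {P} a alg = ∀ (p : Fin P) → P * flops p (Algorithm.trace alg) ≤ a * n ^ 3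

module Submission where

open import Defs
open import Data.Nat using (ℕ; _*_; _^_; _≤_)
open import Data.Fin using (Fin)
open import Data.Product using (∃-syntax)

-- Charge every scalar product a_ik b_kj to a processor p that performed it and
-- whose result either stayed with the final holder of c_ij (p is that holder) or
-- left p inside a partial sum of c_ij that p sent.  The products charged to p
-- then project into p's footprints: the entries of A and B it owned or received,
-- and the entries of C it holds at the end or sent partial sums of.  A
-- Loomis–Whitney-type inequality bounds the number V_p of charged products by
-- V_p² ≤ Z_p³, Z_p the total footprint size, while V_p ≤ flops_p ≤ a n³ / P.
-- Summing P V_p³ ≤ a n³ Z_p³ over p (a Hölder-type step), with Σ V_p = n³ and
-- Σ Z_p ≤ 3n² + P w for w the largest word count, gives P n⁶ ≤ a (3n² + P w)³.
-- Once P > 216 a the term 3n² cannot dominate, which leaves n⁶ ≤ 8 a w³ P².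

open import Data.Nat using (zero; suc; _+_; _<_; NonZero; z≤n; >-nonZero)
open import Data.Nat.Properties hiding (_≟_)
open import Data.Nat.Solver using (module +-*-Solver)
open import Data.Fin using (_≟_) renaming (zero to fzero; suc to fsuc)
import Data.Fin.Subset as Subset
open import Data.Fin.Subset.Properties using (∈⊤; x∈⁅y⁆⇒x≡y; x∈p∪q⁻)
open import Data.List using (List; []; _∷_; allFin)
open import Data.List.Extrema.Nat using (argmax; f[xs]≤f[argmax])
open import Data.List.Membership.Propositional using (_∈_)
open import Data.List.Membership.Propositional.Properties using (∈-allFin)
open import Data.List.Relation.Unary.All using (lookup)
open import Data.List.Relation.Unary.Any using (here; there)
open import Data.Product using (_×_; _,_; proj₁; proj₂)
open import Data.Sum using (_⊎_; inj₁; inj₂)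
open import Function using (_∘_)
open import Relation.Binary.PropositionalEquality
open import Relation.Nullary using (Dec; yes; no; contradiction)
open import Algebra.Properties.Semiring.Sum +-*-semiring
open import Algebra.Properties.CommutativeSemigroup +-commutativeSemigroup
  using () renaming (interchange to +-interchange)

open +-*-Solver

δ : ∀ {m} → Fin m → Fin m → ℕ
δ x y with x ≟ y
... | yes _ = 1
... | no  _ = 0

δ-refl : ∀ {m} (x : Fin m) → δ x x ≡ 1
δ-refl x with x ≟ x
... | yes _   = refl
... | no  x≢x = contradiction refl x≢x

δ-suc : ∀ {m} (x y : Fin m) → δ (fsuc x) (fsuc y) ≡ δ x y
δ-suc x y with x ≟ y
... | yes refl = refl
... | no  _    = refl

δ≤ : ∀ {m} {x : Fin m} (f : Fin m → ℕ) → 1 ≤ f x → ∀ y → δ x y ≤ f y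
δ≤ {x = x} f 1≤fx y with x ≟ y
... | yes refl = 1≤fx
... | no  _    = z≤n

∑-mono-≤ : ∀ {m} {f g : Fin m → ℕ} → (∀ i → f i ≤ g i) → sum f ≤ sum g
∑-mono-≤ {zero}  f≤g = z≤n
∑-mono-≤ {suc m} f≤g = +-mono-≤ (f≤g fzero) (∑-mono-≤ (f≤g ∘ fsuc))

∑-const : ∀ m c → ∑[ i < m ] c ≡ m * c
∑-const zero    c = refl
∑-const (suc m) c = cong (c +_) (∑-const m c)

∑-δ : ∀ {m} (x : Fin m) (f : Fin m → ℕ) → ∑[ y < m ] (δ x y * f y) ≡ f x
∑-δ {suc m} fzero f = begin
  δ (fzero {m}) fzero * f fzero + ∑[ y < m ] 0  ≡⟨ cong₂ _+_ (cong (_* f fzero) (δ-refl (fzero {m})))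
                                                             (sum-replicate-zero m) ⟩
  1 * f fzero + 0                               ≡⟨ trans (+-identityʳ _) (*-identityˡ _) ⟩
  f fzero                                       ∎
  where open ≡-Reasoning
∑-δ {suc m} (fsuc x) f =
  trans (sum-cong-≗ (λ y → cong (_* f (fsuc y)) (δ-suc x y))) (∑-δ x (f ∘ fsuc))

∑-δ-one : ∀ {m} (x : Fin m) → ∑[ y < m ] δ x y ≡ 1
∑-δ-one x = trans (sum-cong-≗ (λ y → sym (*-identityʳ (δ x y)))) (∑-δ x (λ _ → 1))

sum-*-sum : ∀ {m l} (f : Fin m → ℕ) (g : Fin l → ℕ) →
            sum f * sum g ≡ ∑[ i < m ] ∑[ j < l ] (f i * g j)
sum-*-sum f g = trans (*-distribʳ-sum (sum g) f) (sum-cong-≗ (λ i → *-distribˡ-sum (f i) g))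

∑₂ : ∀ {m} → (Fin m → Fin m → ℕ) → ℕ
∑₂ {m} f = ∑[ x < m ] ∑[ y < m ] f x y

∑₃ : ∀ {m} → (Fin m → Fin m → Fin m → ℕ) → ℕ
∑₃ {m} f = ∑[ x < m ] ∑₂ (f x)

∑₂-mono-≤ : ∀ {m} {f g : Fin m → Fin m → ℕ} →
            (∀ x y → f x y ≤ g x y) → ∑₂ f ≤ ∑₂ g
∑₂-mono-≤ f≤g = ∑-mono-≤ (∑-mono-≤ ∘ f≤g)

∑₃-mono-≤ : ∀ {m} {f g : Fin m → Fin m → Fin m → ℕ} →
            (∀ x y z → f x y z ≤ g x y z) → ∑₃ f ≤ ∑₃ g
∑₃-mono-≤ f≤g = ∑-mono-≤ (∑₂-mono-≤ ∘ f≤g)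

∑₂-distrib-+ : ∀ {m} (f g : Fin m → Fin m → ℕ) →
               ∑₂ (λ x y → f x y + g x y) ≡ ∑₂ f + ∑₂ g
∑₂-distrib-+ f g =
  trans (sum-cong-≗ (λ x → ∑-distrib-+ (f x) (g x))) (∑-distrib-+ (sum ∘ f) (sum ∘ g))

∑₂-zero : ∀ {m} → ∑₂ {m} (λ _ _ → 0) ≡ 0
∑₂-zero {m} = trans (sum-cong-≗ {m} (λ _ → sum-replicate-zero m)) (sum-replicate-zero m)

∑₃-zero : ∀ {m} → ∑₃ {m} (λ _ _ _ → 0) ≡ 0
∑₃-zero {m} = trans (sum-cong-≗ {m} (λ _ → ∑₂-zero {m})) (sum-replicate-zero m)

∑₂-one : ∀ {m} → ∑₂ {m} (λ _ _ → 1) ≡ m ^ 2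
∑₂-one {m} = trans (sum-cong-≗ {m} (λ _ → ∑-const m 1)) (∑-const m (m * 1))

∑₃-one : ∀ {m} → ∑₃ {m} (λ _ _ _ → 1) ≡ m ^ 3
∑₃-one {m} = trans (sum-cong-≗ {m} (λ _ → ∑₂-one {m})) (∑-const m (m ^ 2))

∑₂-δ : ∀ {m} (x₀ y₀ : Fin m) c → ∑₂ (λ x y → δ y₀ y * (δ x₀ x * c)) ≡ c
∑₂-δ x₀ y₀ c =
  trans (sum-cong-≗ (λ x → ∑-δ y₀ (λ _ → δ x₀ x * c))) (∑-δ x₀ (λ _ → c))

∑₃-δ : ∀ {m} (x₀ y₀ z₀ : Fin m) c →
       ∑₃ (λ x y z → δ z₀ z * (δ y₀ y * (δ x₀ x * c))) ≡ c
∑₃-δ x₀ y₀ z₀ c =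
  trans (sum-cong-≗ (λ x → ∑₂-δ y₀ z₀ (δ x₀ x * c))) (∑-δ x₀ (λ _ → c))

∑-∑₂-comm : ∀ {l m} (f : Fin l → Fin m → Fin m → ℕ) →
            ∑[ p < l ] ∑₂ (f p) ≡ ∑₂ (λ x y → ∑[ p < l ] f p x y)
∑-∑₂-comm f =
  trans (∑-comm (λ p x → sum (f p x))) (sum-cong-≗ (λ x → ∑-comm (λ p → f p x)))

∑-∑₃-comm : ∀ {l m} (f : Fin l → Fin m → Fin m → Fin m → ℕ) →
            ∑[ p < l ] ∑₃ (f p) ≡ ∑₃ (λ x y z → ∑[ p < l ] f p x y z)
∑-∑₃-comm f =
  trans (∑-comm (λ p x → ∑₂ (f p x))) (sum-cong-≗ (λ x → ∑-∑₂-comm (λ p → f p x)))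

∑-δ-owner : ∀ {l m} (f : Fin m → Fin m → Fin l) → ∑[ p < l ] ∑₂ (λ x y → δ (f x y) p) ≡ m ^ 2
∑-δ-owner {l} {m} f = begin
  ∑[ p < l ] ∑₂ (λ x y → δ (f x y) p)  ≡⟨ ∑-∑₂-comm (λ p x y → δ (f x y) p) ⟩
  ∑₂ (λ x y → ∑[ p < l ] δ (f x y) p)  ≡⟨ sum-cong-≗ (λ x → sum-cong-≗ (λ y → ∑-δ-one (f x y))) ⟩
  ∑₂ {m} (λ _ _ → 1)                   ≡⟨ ∑₂-one {m} ⟩
  m ^ 2                                ∎
  where open ≡-Reasoning

^-cancelˡ-≤ : ∀ d .{{_ : NonZero d}} {x y} → x ^ d ≤ y ^ d → x ≤ y
^-cancelˡ-≤ d xᵈ≤yᵈ = ≮⇒≥ (λ y<x → <⇒≱ (^-monoˡ-< d y<x) xᵈ≤yᵈ)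

-- In square-sum-≤ and cube-sum-≤ a mixed term of the expansion is bounded through its
-- square (resp. cube), which factors into the termwise and the inductive hypothesis.
square-sum-≤ : ∀ {m} c (x y : Fin m → ℕ) →
               (∀ i → x i ^ 2 ≤ c * y i ^ 2) → sum x ^ 2 ≤ c * sum y ^ 2
square-sum-≤ {zero}  c x y _ = z≤n
square-sum-≤ {suc m} c x y x≤y = begin
    (x₀ + X) ^ 2                                 ≡⟨ expand x₀ X ⟩
    x₀ ^ 2 + 2 * (x₀ * X) + X ^ 2
      ≤⟨ +-mono-≤ (+-mono-≤ (x≤y fzero) (*-monoʳ-≤ 2 cross)) rest ⟩
    c * y₀ ^ 2 + 2 * (c * (y₀ * Y)) + c * Y ^ 2  ≡⟨ factor c y₀ Y ⟩
    c * (y₀ + Y) ^ 2                             ∎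
  where
  open ≤-Reasoning
  x₀ = x fzero
  y₀ = y fzero
  X = sum (x ∘ fsuc)
  Y = sum (y ∘ fsuc)
  rest : X ^ 2 ≤ c * Y ^ 2
  rest = square-sum-≤ c (x ∘ fsuc) (y ∘ fsuc) (x≤y ∘ fsuc)
  expand : ∀ a b → (a + b) ^ 2 ≡ a ^ 2 + 2 * (a * b) + b ^ 2
  expand = solve 2 (λ a b → (a :+ b) :^ 2 := a :^ 2 :+ con 2 :* (a :* b) :+ b :^ 2) refl
  factor : ∀ c a b → c * a ^ 2 + 2 * (c * (a * b)) + c * b ^ 2 ≡ c * (a + b) ^ 2
  factor = solve 3 (λ c a b → c :* a :^ 2 :+ con 2 :* (c :* (a :* b)) :+ c :* b :^ 2
                           := c :* (a :+ b) :^ 2) refl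
  split : ∀ a b → (a * b) ^ 2 ≡ a ^ 2 * b ^ 2
  split = solve 2 (λ a b → (a :* b) :^ 2 := a :^ 2 :* b :^ 2) refl
  split-c : ∀ c a b → (c * (a * b)) ^ 2 ≡ (c * a ^ 2) * (c * b ^ 2)
  split-c = solve 3 (λ c a b → (c :* (a :* b)) :^ 2 := (c :* a :^ 2) :* (c :* b :^ 2)) refl
  cross : x₀ * X ≤ c * (y₀ * Y)
  cross = ^-cancelˡ-≤ 2 (begin
    (x₀ * X) ^ 2                ≡⟨ split x₀ X ⟩
    x₀ ^ 2 * X ^ 2              ≤⟨ *-mono-≤ (x≤y fzero) rest ⟩
    (c * y₀ ^ 2) * (c * Y ^ 2)  ≡⟨ split-c c y₀ Y ⟨
    (c * (y₀ * Y)) ^ 2          ∎)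

cube-sum-≤ : ∀ {m} A B (x y : Fin m → ℕ) → (∀ i → A * x i ^ 3 ≤ B * y i ^ 3) →
             A * sum x ^ 3 ≤ B * sum y ^ 3
cube-sum-≤ {zero}  A B x y _ = ≤-trans (≤-reflexive (*-zeroʳ A)) z≤n
cube-sum-≤ {suc m} A B x y x≤y = begin
    A * (x₀ + X) ^ 3                                                    ≡⟨ expand A x₀ X ⟩
    A * x₀ ^ 3 + 3 * (A * (x₀ ^ 2 * X)) + 3 * (A * (x₀ * X ^ 2)) + A * X ^ 3
      ≤⟨ +-mono-≤ (+-mono-≤ (+-mono-≤ (x≤y fzero) (*-monoʳ-≤ 3 cross₁)) (*-monoʳ-≤ 3 cross₂)) rest ⟩
    B * y₀ ^ 3 + 3 * (B * (y₀ ^ 2 * Y)) + 3 * (B * (y₀ * Y ^ 2)) + B * Y ^ 3 ≡⟨ expand B y₀ Y ⟨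
    B * (y₀ + Y) ^ 3                                                    ∎
  where
  open ≤-Reasoning
  x₀ = x fzero
  y₀ = y fzero
  X = sum (x ∘ fsuc)
  Y = sum (y ∘ fsuc)
  rest : A * X ^ 3 ≤ B * Y ^ 3
  rest = cube-sum-≤ A B (x ∘ fsuc) (y ∘ fsuc) (x≤y ∘ fsuc)
  expand : ∀ c a b →
           c * (a + b) ^ 3 ≡ c * a ^ 3 + 3 * (c * (a ^ 2 * b)) + 3 * (c * (a * b ^ 2)) + c * b ^ 3
  expand = solve 3 (λ c a b → c :* (a :+ b) :^ 3
                           := c :* a :^ 3 :+ con 3 :* (c :* (a :^ 2 :* b))
                              :+ con 3 :* (c :* (a :* b :^ 2)) :+ c :* b :^ 3) refl
  split : ∀ c a b → (c * (a ^ 2 * b)) ^ 3 ≡ (c * a ^ 3) * (c * a ^ 3) * (c * b ^ 3)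
  split = solve 3 (λ c a b → (c :* (a :^ 2 :* b)) :^ 3
                          := (c :* a :^ 3) :* (c :* a :^ 3) :* (c :* b :^ 3)) refl
  cross₁ : A * (x₀ ^ 2 * X) ≤ B * (y₀ ^ 2 * Y)
  cross₁ = ^-cancelˡ-≤ 3 (begin
    (A * (x₀ ^ 2 * X)) ^ 3                        ≡⟨ split A x₀ X ⟩
    (A * x₀ ^ 3) * (A * x₀ ^ 3) * (A * X ^ 3)     ≤⟨ *-mono-≤ (*-mono-≤ (x≤y fzero) (x≤y fzero)) rest ⟩
    (B * y₀ ^ 3) * (B * y₀ ^ 3) * (B * Y ^ 3)     ≡⟨ split B y₀ Y ⟨
    (B * (y₀ ^ 2 * Y)) ^ 3                        ∎)
  cross₂ : A * (x₀ * X ^ 2) ≤ B * (y₀ * Y ^ 2)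
  cross₂ = ^-cancelˡ-≤ 3 (begin
    (A * (x₀ * X ^ 2)) ^ 3                        ≡⟨ split′ A X x₀ ⟩
    (A * X ^ 3) * (A * X ^ 3) * (A * x₀ ^ 3)      ≤⟨ *-mono-≤ (*-mono-≤ rest rest) (x≤y fzero) ⟩
    (B * Y ^ 3) * (B * Y ^ 3) * (B * y₀ ^ 3)      ≡⟨ split′ B Y y₀ ⟨
    (B * (y₀ * Y ^ 2)) ^ 3                        ∎)
    where
    split′ : ∀ c a b → (c * (b * a ^ 2)) ^ 3 ≡ (c * a ^ 3) * (c * a ^ 3) * (c * b ^ 3)
    split′ c a b = trans (cong (λ t → (c * t) ^ 3) (*-comm b (a ^ 2))) (split c a b)

loomis-whitney : ∀ {m} (u : Fin m → Fin m → Fin m → ℕ) (a b c : Fin m → Fin m → ℕ) →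
                 (∀ k i j → u k i j ≤ a k i * b k j) → (∀ k i j → u k i j ≤ c i j) →
                 ∑₃ u ^ 2 ≤ (∑₂ a + ∑₂ b + ∑₂ c) ^ 3
loomis-whitney {m} u a b c u≤ab u≤c = begin
    ∑₃ u ^ 2                  ≤⟨ square-sum-≤ (∑₂ c) (∑₂ ∘ u) s slice-bound ⟩
    ∑₂ c * sum s ^ 2          ≡⟨ cong (λ t → ∑₂ c * t ^ 2) (∑-distrib-+ (sum ∘ a) (sum ∘ b)) ⟩
    ∑₂ c * (∑₂ a + ∑₂ b) ^ 2  ≤⟨ *-mono-≤ (m≤n+m (∑₂ c) (∑₂ a + ∑₂ b))
                                          (^-monoˡ-≤ 2 (m≤m+n (∑₂ a + ∑₂ b) (∑₂ c))) ⟩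
    (∑₂ a + ∑₂ b + ∑₂ c) ^ 3  ∎
  where
  open ≤-Reasoning
  s : Fin m → ℕ
  s k = sum (a k) + sum (b k)
  slice-bound : ∀ k → ∑₂ (u k) ^ 2 ≤ ∑₂ c * s k ^ 2
  slice-bound k = *-mono-≤ (∑₂-mono-≤ (u≤c k)) (begin
    ∑₂ (u k) * 1                       ≡⟨ *-identityʳ _ ⟩
    ∑₂ (u k)                           ≤⟨ ∑₂-mono-≤ (u≤ab k) ⟩
    ∑₂ (λ i j → a k i * b k j)         ≡⟨ sum-*-sum (a k) (b k) ⟨
    sum (a k) * sum (b k)              ≤⟨ *-mono-≤ (m≤m+n (sum (a k)) (sum (b k)))
                                                   (m≤n+m (sum (b k)) (sum (a k))) ⟩
    s k * s k                          ≡⟨ cong (s k *_) (*-identityʳ (s k)) ⟨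
    s k ^ 2                            ∎)

count : ∀ {a} {A : Set a} → (A → ℕ) → List A → ℕ
count w []       = 0
count w (x ∷ xs) = w x + count w xs

count-∈ : ∀ {a} {A : Set a} (w : A → ℕ) {x xs} → x ∈ xs → w x ≤ count w xs
count-∈ w {xs = _ ∷ xs} (here refl) = m≤m+n _ (count w xs)
count-∈ w {xs = y ∷ _}  (there x∈xs) = ≤-trans (count-∈ w x∈xs) (m≤n+m _ (w y))

count-mono-≤ : ∀ {a} {A : Set a} {v w : A → ℕ} →
               (∀ x → v x ≤ w x) → ∀ xs → count v xs ≤ count w xs
count-mono-≤ v≤w []       = z≤n
count-mono-≤ v≤w (x ∷ xs) = +-mono-≤ (v≤w x) (count-mono-≤ v≤w xs)

count-distrib-+ : ∀ {a} {A : Set a} (v w : A → ℕ) xs →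
                  count (λ x → v x + w x) xs ≡ count v xs + count w xs
count-distrib-+ v w []       = refl
count-distrib-+ v w (x ∷ xs) =
  trans (cong (v x + w x +_) (count-distrib-+ v w xs)) (+-interchange (v x) (w x) _ _)

∑-count : ∀ {a} {A : Set a} {m} (w : Fin m → A → ℕ) xs →
          ∑[ y < m ] count (w y) xs ≡ count (λ x → ∑[ y < m ] w y x) xs
∑-count {m = m} w []       = sum-replicate-zero m
∑-count         w (x ∷ xs) =
  trans (∑-distrib-+ (λ y → w y x) (λ y → count (w y) xs)) (cong (_ +_) (∑-count w xs))

∑₂-count : ∀ {a} {A : Set a} {m} (w : Fin m → Fin m → A → ℕ) xs →
           ∑₂ (λ y z → count (w y z) xs) ≡ count (λ x → ∑₂ (λ y z → w y z x)) xs
∑₂-count w xs =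
  trans (sum-cong-≗ (λ y → ∑-count (w y) xs)) (∑-count (λ y x → sum (λ z → w y z x)) xs)

∑₃-count : ∀ {a} {A : Set a} {m} (w : Fin m → Fin m → Fin m → A → ℕ) xs →
           ∑₃ (λ y z t → count (w y z t) xs) ≡ count (λ x → ∑₃ (λ y z t → w y z t x)) xs
∑₃-count w xs =
  trans (sum-cong-≗ (λ y → ∑₂-count (w y) xs)) (∑-count (λ y x → ∑₂ (λ z t → w y z t x)) xs)

-- Contributions of one event to the counts charged to processor p.  A product is
-- indexed (k, i, j), so that its A-, B- and C-entries are the projections (k, i),
-- (k, j) and (i, j).  Received entries of A and B are charged to the receiver,
-- partial sums of C to the sender.  The δ factors are nested innermost summation
-- index first, the shape evaluated by ∑₂-δ and ∑₃-δ.
module _ {n P : ℕ} where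

  mulWeight : Fin P → Fin n → Fin n → Fin n → Event n P → ℕ
  mulWeight p k i j (mul q i′ j′ k′) = δ j′ j * (δ i′ i * (δ k′ k * δ p q))
  mulWeight p k i j _                = 0

  recvAWeight : Fin P → Fin n → Fin n → Event n P → ℕ
  recvAWeight p k i (send _ r (inA i′ k′)) = δ i′ i * (δ k′ k * δ p r)
  recvAWeight p k i _                      = 0

  recvBWeight : Fin P → Fin n → Fin n → Event n P → ℕ
  recvBWeight p k j (send _ r (inB k′ j′)) = δ j′ j * (δ k′ k * δ p r)
  recvBWeight p k j _                      = 0

  sentCWeight : Fin P → Fin n → Fin n → Event n P → ℕ
  sentCWeight p i j (send q _ (psum i′ j′ _)) = δ j′ j * (δ i′ i * δ p q)
  sentCWeight p i j _                         = 0

  flopsWeight : Fin P → Event n P → ℕ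
  flopsWeight p (send _ _ _)    = 0
  flopsWeight p (mul q _ _ _)   = δ p q
  flopsWeight p (add q _ _ _ _) = δ p q

  wordsWeight : Fin P → Event n P → ℕ
  wordsWeight p (send q r _) = δ p q + δ p r
  wordsWeight p _            = 0

  flops≡count : ∀ p es → flops p es ≡ count (flopsWeight p) es
  flops≡count p []                  = refl
  flops≡count p (send _ _ _ ∷ es)   = flops≡count p es
  flops≡count p (mul q _ _ _ ∷ es) with p ≟ q
  ... | yes _ = cong suc (flops≡count p es)
  ... | no  _ = flops≡count p es
  flops≡count p (add q _ _ _ _ ∷ es) with p ≟ q
  ... | yes _ = cong suc (flops≡count p es)
  ... | no  _ = flops≡count p es

  words≡count : ∀ p es → words p es ≡ count (wordsWeight p) es
  words≡count p []                    = refl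
  words≡count p (send q r _ ∷ es) with p ≟ q | p ≟ r
  ... | yes _ | yes _ = cong (2 +_) (words≡count p es)
  ... | yes _ | no  _ = cong suc (words≡count p es)
  ... | no  _ | yes _ = cong suc (words≡count p es)
  ... | no  _ | no  _ = words≡count p es
  words≡count p (mul _ _ _ _ ∷ es)   = words≡count p es
  words≡count p (add _ _ _ _ _ ∷ es) = words≡count p es

  mulCount : Fin P → Fin n → Fin n → Fin n → Trace n P → ℕ
  mulCount p k i j = count (mulWeight p k i j)

  traffic : Fin P → Trace n P → ℕ
  traffic p es = ∑₂ (λ k i → count (recvAWeight p k i) es)
               + ∑₂ (λ k j → count (recvBWeight p k j) es)
               + ∑₂ (λ i j → count (sentCWeight p i j) es)

  ∑₃-mulWeight≤flopsWeight : ∀ p e → ∑₃ (λ k i j → mulWeight p k i j e) ≤ flopsWeight p e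
  ∑₃-mulWeight≤flopsWeight p (send _ _ _)        = ≤-reflexive (∑₃-zero {n})
  ∑₃-mulWeight≤flopsWeight p (mul q i′ j′ k′)    = ≤-reflexive (∑₃-δ k′ i′ j′ (δ p q))
  ∑₃-mulWeight≤flopsWeight p (add _ _ _ _ _)     = ≤-trans (≤-reflexive (∑₃-zero {n})) z≤n

  mulCount≤flops : ∀ p es → ∑₃ (λ k i j → mulCount p k i j es) ≤ flops p es
  mulCount≤flops p es = begin
    ∑₃ (λ k i j → mulCount p k i j es)                    ≡⟨ ∑₃-count (mulWeight p) es ⟩
    count (λ e → ∑₃ (λ k i j → mulWeight p k i j e)) es   ≤⟨ count-mono-≤ (∑₃-mulWeight≤flopsWeight p) es ⟩
    count (flopsWeight p) es                              ≡⟨ flops≡count p es ⟨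
    flops p es                                            ∎
    where open ≤-Reasoning

  eventTraffic : Fin P → Event n P → ℕ
  eventTraffic p e = ∑₂ (λ k i → recvAWeight p k i e) + ∑₂ (λ k j → recvBWeight p k j e)
                   + ∑₂ (λ i j → sentCWeight p i j e)

  eventTraffic≤wordsWeight : ∀ p e → eventTraffic p e ≤ wordsWeight p e
  eventTraffic≤wordsWeight p (send q r (inA i k)) = begin
    ∑₂ (λ k′ i′ → δ i i′ * (δ k k′ * δ p r)) + ∑₂ {n} (λ _ _ → 0) + ∑₂ {n} (λ _ _ → 0)
      ≡⟨ cong₂ _+_ (cong₂ _+_ (∑₂-δ k i (δ p r)) (∑₂-zero {n})) (∑₂-zero {n}) ⟩
    δ p r + 0 + 0     ≡⟨ trans (+-identityʳ _) (+-identityʳ _) ⟩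
    δ p r             ≤⟨ m≤n+m (δ p r) (δ p q) ⟩
    δ p q + δ p r     ∎
    where open ≤-Reasoning
  eventTraffic≤wordsWeight p (send q r (inB k j)) = begin
    ∑₂ {n} (λ _ _ → 0) + ∑₂ (λ k′ j′ → δ j j′ * (δ k k′ * δ p r)) + ∑₂ {n} (λ _ _ → 0)
      ≡⟨ cong₂ _+_ (cong₂ _+_ (∑₂-zero {n}) (∑₂-δ k j (δ p r))) (∑₂-zero {n}) ⟩
    0 + δ p r + 0     ≡⟨ +-identityʳ _ ⟩
    δ p r             ≤⟨ m≤n+m (δ p r) (δ p q) ⟩
    δ p q + δ p r     ∎
    where open ≤-Reasoning
  eventTraffic≤wordsWeight p (send q r (psum i j _)) = begin
    ∑₂ {n} (λ _ _ → 0) + ∑₂ {n} (λ _ _ → 0) + ∑₂ (λ i′ j′ → δ j j′ * (δ i i′ * δ p q))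
      ≡⟨ cong₂ _+_ (cong₂ _+_ (∑₂-zero {n}) (∑₂-zero {n})) (∑₂-δ i j (δ p q)) ⟩
    δ p q             ≤⟨ m≤m+n (δ p q) (δ p r) ⟩
    δ p q + δ p r     ∎
    where open ≤-Reasoning
  eventTraffic≤wordsWeight p (mul _ _ _ _) =
    ≤-reflexive (cong₂ _+_ (cong₂ _+_ (∑₂-zero {n}) (∑₂-zero {n})) (∑₂-zero {n}))
  eventTraffic≤wordsWeight p (add _ _ _ _ _) =
    ≤-reflexive (cong₂ _+_ (cong₂ _+_ (∑₂-zero {n}) (∑₂-zero {n})) (∑₂-zero {n}))

  traffic≤words : ∀ p es → traffic p es ≤ words p es
  traffic≤words p es = begin
    traffic p es
      ≡⟨ cong₂ _+_ (cong₂ _+_ (∑₂-count (recvAWeight p) es) (∑₂-count (recvBWeight p) es))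
                   (∑₂-count (sentCWeight p) es) ⟩
    count A es + count B es + count C es
      ≡⟨ trans (count-distrib-+ (λ e → A e + B e) C es) (cong (_+ count C es) (count-distrib-+ A B es)) ⟨
    count (eventTraffic p) es                 ≤⟨ count-mono-≤ (eventTraffic≤wordsWeight p) es ⟩
    count (wordsWeight p) es                  ≡⟨ words≡count p es ⟨
    words p es                                ∎
    where
    open ≤-Reasoning
    A B C : Event n P → ℕ
    A e = ∑₂ (λ k i → recvAWeight p k i e)
    B e = ∑₂ (λ k j → recvBWeight p k j e)
    C e = ∑₂ (λ i j → sentCWeight p i j e)

  mulWeight-self : ∀ (p : Fin P) (i j k : Fin n) → 1 ≤ mulWeight p k i j (mul p i j k)
  mulWeight-self p i j k rewrite δ-refl j | δ-refl i | δ-refl k | δ-refl p = ≤-refl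

  recvAWeight-self : ∀ (q p : Fin P) (i k : Fin n) → 1 ≤ recvAWeight p k i (send q p (inA i k))
  recvAWeight-self _ p i k rewrite δ-refl i | δ-refl k | δ-refl p = ≤-refl

  recvBWeight-self : ∀ (q p : Fin P) (k j : Fin n) → 1 ≤ recvBWeight p k j (send q p (inB k j))
  recvBWeight-self _ p k j rewrite δ-refl j | δ-refl k | δ-refl p = ≤-refl

  sentCWeight-self : ∀ (p r : Fin P) (i j : Fin n) T → 1 ≤ sentCWeight p i j (send p r (psum i j T))
  sentCWeight-self p _ i j _ rewrite δ-refl j | δ-refl i | δ-refl p = ≤-refl

-- Kept opaque so that the lemmas below can be applied by unification.
opaque
  footprint : ∀ {n P} → (Fin n → Fin n → Fin P) → (Fin P → Fin n → Fin n → Event n P → ℕ) →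
              Fin P → Fin n → Fin n → Trace n P → ℕ
  footprint owner weight p x y es = δ (owner x y) p + count (weight p x y) es

  footprint-∷ : ∀ {n P owner weight p} {x y : Fin n} e es →
                footprint {n} {P} owner weight p x y es ≤ footprint owner weight p x y (e ∷ es)
  footprint-∷ {owner = owner} {weight} {p} {x} {y} e es =
    +-monoʳ-≤ (δ (owner x y) p) (m≤n+m _ (weight p x y e))

  owner⇒footprint : ∀ {n P owner weight p} {x y : Fin n} {es} →
                    owner x y ≡ p → 1 ≤ footprint {n} {P} owner weight p x y es
  owner⇒footprint {weight = weight} {p} {x} {y} {es} refl =
    ≤-trans (≤-reflexive (sym (δ-refl p))) (m≤m+n (δ p p) (count (weight p x y) es))

  counted⇒footprint : ∀ {n P owner weight p} {x y : Fin n} {e es} →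
                      e ∈ es → 1 ≤ weight p x y e → 1 ≤ footprint {n} {P} owner weight p x y es
  counted⇒footprint {owner = owner} {weight} {p} {x} {y} e∈es 1≤w =
    ≤-trans (≤-trans 1≤w (count-∈ (weight p x y) e∈es)) (m≤n+m _ (δ (owner x y) p))

  ∑₂-footprint : ∀ {n P} owner weight (p : Fin P) es →
                 ∑₂ (λ x y → footprint {n} owner weight p x y es)
                 ≡ ∑₂ (λ x y → δ (owner x y) p) + ∑₂ (λ x y → count (weight p x y) es)
  ∑₂-footprint owner weight p es =
    ∑₂-distrib-+ (λ x y → δ (owner x y) p) (λ x y → count (weight p x y) es)

module Provenance {n P : ℕ} (ownA ownB : Fin n → Fin n → Fin P) where

  footprintA : Fin P → Fin n → Fin n → Trace n P → ℕ
  footprintA = footprint (λ k i → ownA i k) recvAWeight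

  footprintB : Fin P → Fin n → Fin n → Trace n P → ℕ
  footprintB = footprint ownB recvBWeight

  held⇒footprintA : ∀ {es p i k} → Holds ownA ownB es p (inA i k) → 1 ≤ footprintA p k i es
  held⇒footprintA (initA owned)     = owner⇒footprint owned
  held⇒footprintA (keep {es} {e} h) = ≤-trans (held⇒footprintA h) (footprint-∷ e es)
  held⇒footprintA {p = p} {i} {k} (recv {q = q}) =
    counted⇒footprint (here refl) (recvAWeight-self q p i k)

  held⇒footprintB : ∀ {es p k j} → Holds ownA ownB es p (inB k j) → 1 ≤ footprintB p k j es
  held⇒footprintB (initB owned)     = owner⇒footprint owned
  held⇒footprintB (keep {es} {e} h) = ≤-trans (held⇒footprintB h) (footprint-∷ e es)
  held⇒footprintB {p = p} {k} {j} (recv {q = q}) =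
    counted⇒footprint (here refl) (recvBWeight-self q p k j)

  valid-tail : ∀ {e es} → Valid ownA ownB (e ∷ es) → Valid ownA ownB es
  valid-tail (vsend v _)    = v
  valid-tail (vmul v _ _)   = v
  valid-tail (vadd v _ _ _) = v

  multiplied⇒footprints : ∀ {es p i j k} → Valid ownA ownB es → mul p i j k ∈ es →
                          1 ≤ footprintA p k i es × 1 ≤ footprintB p k j es
  multiplied⇒footprints {e ∷ es} (vmul _ hA hB) (here refl) =
    ≤-trans (held⇒footprintA hA) (footprint-∷ e es) ,
    ≤-trans (held⇒footprintB hB) (footprint-∷ e es)
  multiplied⇒footprints {e ∷ es} v (there m) with multiplied⇒footprints (valid-tail v) m
  ... | a , b = ≤-trans a (footprint-∷ e es) , ≤-trans b (footprint-∷ e es)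

  SentPartialSum : Trace n P → Fin P → Fin n → Fin n → Set
  SentPartialSum es p i j = ∃[ q ] ∃[ T ] send p q (psum i j T) ∈ es

  Origin : Trace n P → Fin P → Fin n → Fin n → Fin n → Set
  Origin es x i j k = ∃[ p ] mul p i j k ∈ es × (p ≡ x ⊎ SentPartialSum es p i j)

  origin-∷ : ∀ {e es x i j k} → Origin es x i j k → Origin (e ∷ es) x i j k
  origin-∷ (p , m , inj₁ p≡x)         = p , there m , inj₁ p≡x
  origin-∷ (p , m , inj₂ (q , T , s)) = p , there m , inj₂ (q , T , there s)

  origin : ∀ {es x i j T k} → Valid ownA ownB es → Holds ownA ownB es x (psum i j T) →
           k Subset.∈ T → Origin es x i j k
  origin v (keep h) k∈T = origin-∷ (origin (valid-tail v) h k∈T)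
  origin (vsend v h) recv k∈T with origin v h k∈T
  ... | p , m , inj₁ refl         = p , there m , inj₂ (_ , _ , here refl)
  ... | p , m , inj₂ (r , U , s)  = p , there m , inj₂ (r , U , there s)
  origin _ mulR k∈⁅k′⁆ with x∈⁅y⁆⇒x≡y _ k∈⁅k′⁆
  ... | refl = _ , here refl , inj₁ refl
  origin (vadd v h₁ h₂ _) addR k∈S∪T with x∈p∪q⁻ _ _ k∈S∪T
  ... | inj₁ k∈S = origin-∷ (origin v h₁ k∈S)
  ... | inj₂ k∈T = origin-∷ (origin v h₂ k∈T)

module Charging {n P : ℕ} (alg : Algorithm n P) where
  open Algorithm alg
  open Provenance ownA ownB

  holder : Fin n → Fin n → Fin P
  holder i j = proj₁ (output i j)

  footprintC : Fin P → Fin n → Fin n → ℕ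
  footprintC p i j = footprint holder sentCWeight p i j trace

  origin-of : ∀ k i j → Origin trace (holder i j) i j k
  origin-of k i j = origin valid (proj₂ (output i j)) ∈⊤

  multiplier : Fin n → Fin n → Fin n → Fin P
  multiplier k i j = proj₁ (origin-of k i j)

  multiplier-multiplied : ∀ k i j → mul (multiplier k i j) i j k ∈ trace
  multiplier-multiplied k i j = proj₁ (proj₂ (origin-of k i j))

  multiplier-mulCount : ∀ k i j → 1 ≤ mulCount (multiplier k i j) k i j trace
  multiplier-mulCount k i j = ≤-trans (mulWeight-self (multiplier k i j) i j k)
                                      (count-∈ (mulWeight (multiplier k i j) k i j) (multiplier-multiplied k i j))

  multiplier-footprintAB : ∀ k i j →
    1 ≤ footprintA (multiplier k i j) k i trace * footprintB (multiplier k i j) k j trace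
  multiplier-footprintAB k i j with multiplied⇒footprints valid (multiplier-multiplied k i j)
  ... | 1≤A , 1≤B = *-mono-≤ 1≤A 1≤B

  multiplier-footprintC : ∀ k i j → 1 ≤ footprintC (multiplier k i j) i j
  multiplier-footprintC k i j with origin-of k i j
  ... | p , _ , inj₁ refl          = owner⇒footprint refl
  ... | p , _ , inj₂ (q , T , sent) = counted⇒footprint sent (sentCWeight-self p q i j T)

  charge : Fin P → Fin n → Fin n → Fin n → ℕ
  charge p k i j = δ (multiplier k i j) p

  footprintSize : Fin P → ℕ
  footprintSize p =
    ∑₂ (λ k i → footprintA p k i trace) + ∑₂ (λ k j → footprintB p k j trace) + ∑₂ (footprintC p)

  charge-loomis-whitney : ∀ p → ∑₃ (charge p) ^ 2 ≤ footprintSize p ^ 3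
  charge-loomis-whitney p =
    loomis-whitney (charge p) (λ k i → footprintA p k i trace) (λ k j → footprintB p k j trace) (footprintC p)
      (λ k i j → δ≤ (λ q → footprintA q k i trace * footprintB q k j trace) (multiplier-footprintAB k i j) p)
      (λ k i j → δ≤ (λ q → footprintC q i j) (multiplier-footprintC k i j) p)

  charge≤flops : ∀ p → ∑₃ (charge p) ≤ flops p trace
  charge≤flops p =
    ≤-trans (∑₃-mono-≤ (λ k i j → δ≤ (λ q → mulCount q k i j trace) (multiplier-mulCount k i j) p))
            (mulCount≤flops p trace)

  ∑-charge : ∑[ p < P ] ∑₃ (charge p) ≡ n ^ 3
  ∑-charge = begin
    ∑[ p < P ] ∑₃ (charge p)                  ≡⟨ ∑-∑₃-comm charge ⟩
    ∑₃ (λ k i j → ∑[ p < P ] charge p k i j)  ≡⟨ sum-cong-≗ (λ k → sum-cong-≗ (λ i → sum-cong-≗ (λ j →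
                                                   ∑-δ-one (multiplier k i j)))) ⟩
    ∑₃ {n} (λ _ _ _ → 1)                      ≡⟨ ∑₃-one {n} ⟩
    n ^ 3                                     ∎
    where open ≡-Reasoning

  owned : Fin P → ℕ
  owned p = ∑₂ (λ k i → δ (ownA i k) p) + ∑₂ (λ k j → δ (ownB k j) p) + ∑₂ (λ i j → δ (holder i j) p)

  footprintSize-split : ∀ p → footprintSize p ≡ owned p + traffic p trace
  footprintSize-split p = begin
    footprintSize p
      ≡⟨ cong₂ _+_ (cong₂ _+_ (∑₂-footprint (λ k i → ownA i k) recvAWeight p trace)
                              (∑₂-footprint ownB recvBWeight p trace))
                   (∑₂-footprint holder sentCWeight p trace) ⟩
    (oA + rA) + (oB + rB) + (oC + rC)  ≡⟨ cong (_+ (oC + rC)) (+-interchange oA rA oB rB) ⟩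
    (oA + oB) + (rA + rB) + (oC + rC)  ≡⟨ +-interchange (oA + oB) (rA + rB) oC rC ⟩
    owned p + traffic p trace          ∎
    where
    open ≡-Reasoning
    oA = ∑₂ (λ k i → δ (ownA i k) p)
    oB = ∑₂ (λ k j → δ (ownB k j) p)
    oC = ∑₂ (λ i j → δ (holder i j) p)
    rA = ∑₂ (λ k i → count (recvAWeight p k i) trace)
    rB = ∑₂ (λ k j → count (recvBWeight p k j) trace)
    rC = ∑₂ (λ i j → count (sentCWeight p i j) trace)

  ∑-owned : ∑[ p < P ] owned p ≡ 3 * n ^ 2
  ∑-owned = begin
    ∑[ p < P ] owned p
      ≡⟨ trans (∑-distrib-+ (λ p → oA p + oB p) oC) (cong (_+ ∑[ p < P ] oC p) (∑-distrib-+ oA oB)) ⟩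
    ∑[ p < P ] oA p + ∑[ p < P ] oB p + ∑[ p < P ] oC p
      ≡⟨ cong₂ _+_ (cong₂ _+_ (∑-δ-owner (λ k i → ownA i k)) (∑-δ-owner ownB)) (∑-δ-owner holder) ⟩
    n ^ 2 + n ^ 2 + n ^ 2
      ≡⟨ solve 1 (λ x → x :+ x :+ x := con 3 :* x) refl (n ^ 2) ⟩
    3 * n ^ 2
      ∎
    where
    open ≡-Reasoning
    oA oB oC : Fin P → ℕ
    oA p = ∑₂ (λ k i → δ (ownA i k) p)
    oB p = ∑₂ (λ k j → δ (ownB k j) p)
    oC p = ∑₂ (λ i j → δ (holder i j) p)

  ∑-footprintSize≤ : ∀ w → (∀ p → words p trace ≤ w) →
                     ∑[ p < P ] footprintSize p ≤ 3 * n ^ 2 + P * w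
  ∑-footprintSize≤ w words≤w = begin
    ∑[ p < P ] footprintSize p                       ≡⟨ sum-cong-≗ footprintSize-split ⟩
    ∑[ p < P ] (owned p + traffic p trace)           ≡⟨ ∑-distrib-+ owned (λ p → traffic p trace) ⟩
    ∑[ p < P ] owned p + ∑[ p < P ] traffic p trace
      ≤⟨ +-mono-≤ (≤-reflexive ∑-owned) (∑-mono-≤ (λ p → ≤-trans (traffic≤words p trace) (words≤w p))) ⟩
    3 * n ^ 2 + ∑[ p < P ] w                         ≡⟨ cong (3 * n ^ 2 +_) (∑-const P w) ⟩
    3 * n ^ 2 + P * w                                ∎
    where open ≤-Reasoning

  volume-inequality : ∀ {a} → ComputeBound a alg → ∀ w → (∀ p → words p trace ≤ w) →
                      P * (n ^ 3) ^ 3 ≤ a * n ^ 3 * (3 * n ^ 2 + P * w) ^ 3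
  volume-inequality {a} compute w words≤w = begin
    P * (n ^ 3) ^ 3                               ≡⟨ cong (λ t → P * t ^ 3) ∑-charge ⟨
    P * (∑[ p < P ] ∑₃ (charge p)) ^ 3            ≤⟨ cube-sum-≤ P (a * n ^ 3) (∑₃ ∘ charge) footprintSize
                                                                 per-processor ⟩
    a * n ^ 3 * (∑[ p < P ] footprintSize p) ^ 3  ≤⟨ *-monoʳ-≤ (a * n ^ 3)
                                                       (^-monoˡ-≤ 3 (∑-footprintSize≤ w words≤w)) ⟩
    a * n ^ 3 * (3 * n ^ 2 + P * w) ^ 3           ∎
    where
    open ≤-Reasoning
    per-processor : ∀ p → P * ∑₃ (charge p) ^ 3 ≤ a * n ^ 3 * footprintSize p ^ 3
    per-processor p = begin
      P * ∑₃ (charge p) ^ 3                  ≡⟨ solve 2 (λ x y → x :* y :^ 3 := x :* y :* y :^ 2) refl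
                                                       P (∑₃ (charge p)) ⟩
      P * ∑₃ (charge p) * ∑₃ (charge p) ^ 2  ≤⟨ *-mono-≤ (≤-trans (*-monoʳ-≤ P (charge≤flops p)) (compute p))
                                                         (charge-loomis-whitney p) ⟩
      a * n ^ 3 * footprintSize p ^ 3        ∎

maximiser : ∀ {m} (f : Fin (suc m) → ℕ) → ∃[ x ] (∀ y → f y ≤ f x)
maximiser {m} f = argmax f fzero (allFin (suc m)) ,
                  λ y → lookup (f[xs]≤f[argmax] {f = f} fzero (allFin (suc m))) (∈-allFin y)

volume⇒words-bound : ∀ a P n w → 216 * a < P →
                     P * (n ^ 3) ^ 3 ≤ a * n ^ 3 * (3 * n ^ 2 + P * w) ^ 3 →
                     n ^ 6 ≤ 8 * a * w ^ 3 * P ^ 2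
volume⇒words-bound a P zero      w _      _      = z≤n
volume⇒words-bound a P n@(suc _) w 216a<P volume = by-cases (3 * n ^ 2 ≤? P * w)
  where
  open ≤-Reasoning
  instance
    P≢0 : NonZero P
    P≢0 = >-nonZero (≤-<-trans z≤n 216a<P)
    n³≢0 : NonZero (n ^ 3)
    n³≢0 = m^n≢0 n 3
    n⁶≢0 : NonZero (n ^ 6)
    n⁶≢0 = m^n≢0 n 6
  X = 3 * n ^ 2 + P * w
  cancelled : P * n ^ 6 ≤ a * X ^ 3
  cancelled = *-cancelˡ-≤ (n ^ 3) (begin
    n ^ 3 * (P * n ^ 6)  ≡⟨ solve 2 (λ n P → n :^ 3 :* (P :* n :^ 6) := P :* (n :^ 3) :^ 3) refl n P ⟩
    P * (n ^ 3) ^ 3      ≤⟨ volume ⟩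
    a * n ^ 3 * X ^ 3    ≡⟨ solve 3 (λ a n X → a :* n :^ 3 :* X :^ 3 := n :^ 3 :* (a :* X :^ 3)) refl a n X ⟩
    n ^ 3 * (a * X ^ 3)  ∎)
  by-cases : Dec (3 * n ^ 2 ≤ P * w) → n ^ 6 ≤ 8 * a * w ^ 3 * P ^ 2
  by-cases (yes 3n²≤Pw) = *-cancelˡ-≤ P (begin
    P * n ^ 6                    ≤⟨ cancelled ⟩
    a * X ^ 3                    ≤⟨ *-monoʳ-≤ a (^-monoˡ-≤ 3 (+-monoˡ-≤ (P * w) 3n²≤Pw)) ⟩
    a * (P * w + P * w) ^ 3      ≡⟨ solve 3 (λ a P w → a :* (P :* w :+ P :* w) :^ 3
                                                   := P :* (con 8 :* a :* w :^ 3 :* P :^ 2)) refl a P w ⟩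
    P * (8 * a * w ^ 3 * P ^ 2)  ∎)
  by-cases (no 3n²≰Pw) = contradiction 216a<P (≤⇒≯ (*-cancelʳ-≤ P (216 * a) (n ^ 6) (begin
    P * n ^ 6                        ≤⟨ cancelled ⟩
    a * X ^ 3                        ≤⟨ *-monoʳ-≤ a (^-monoˡ-≤ 3 (+-monoʳ-≤ (3 * n ^ 2) (<⇒≤ (≰⇒> 3n²≰Pw)))) ⟩
    a * (3 * n ^ 2 + 3 * n ^ 2) ^ 3  ≡⟨ solve 2 (λ a n → a :* (con 3 :* n :^ 2 :+ con 3 :* n :^ 2) :^ 3
                                                       := con 216 :* a :* n :^ 6) refl a n ⟩
    216 * a * n ^ 6                  ∎)))

theorem2 : (a : ℕ) → ∃[ c ] ∃[ P₀ ] (∀ (P : ℕ) → P₀ ≤ P → ∀ (n : ℕ) →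
             (alg : Algorithm n P) → ComputeBound a alg →
             ∃[ p ] (n ^ 6 ≤ c * words p (Algorithm.trace alg) ^ 3 * P ^ 2))
theorem2 a = 8 * a , suc (216 * a) , bound
  where
  bound : ∀ P → 216 * a < P → ∀ n (alg : Algorithm n P) → ComputeBound a alg →
          ∃[ p ] (n ^ 6 ≤ 8 * a * words p (Algorithm.trace alg) ^ 3 * P ^ 2)
  bound zero    ()     _ _   _
  bound (suc P) 216a<P n alg compute with maximiser (λ p → words p (Algorithm.trace alg))
  ... | p , busiest =
    p , volume⇒words-bound a (suc P) n w 216a<P (Charging.volume-inequality alg {a} compute w busiest)
    where w = words p (Algorithm.trace alg)
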